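{- Let $p,q,k$ be positive integers with $p,q$ coprime and $p<q$. Let \[ D_{p,q,k}=\{\pm(q^{2k+j}-q^{2k-j},\,-pq^{j}-2q^{2k}) : j=0,1,\dots,2k-1\}\subseteq\mathbb{Z}^2, \qquad C_{p,q,k}=\bigcup_{j=0}^{\infty}(qj+1)D_{p,q,k}. \] Then the graph $G(\mathbb{Z}^2,C_{p,q,k})$ is triangle-free.
   Context: $(qj+1)D_{p,q,k}$ denotes $\{(qj+1)d: d\in D_{p,q,k}\}$. $G(\mathbb{Z}^2,C)$ is the Cayley graph with vertex set $\mathbb{Z}^2$ in which $u,v$ are adjacent iff $u-v\in C$. -}

module Defs where

open import Data.Nat as ℕ using (ℕ; _∸_; _<_)
open import Data.Empty using (⊥)
open import Data.Integer as ℤ using (ℤ; +_; -_)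
open import Data.Product using (_×_; _,_; Σ; ∃; ∃-syntax)
open import Data.Sum using (_⊎_)
open import Relation.Binary.PropositionalEquality using (_≡_; _≢_)

ℤ² : Set
ℤ² = ℤ × ℤ

_-²_ : ℤ² → ℤ² → ℤ²
(a , b) -² (c , d) = (a ℤ.- c , b ℤ.- d)

_·²_ : ℤ → ℤ² → ℤ²
t ·² (a , b) = (t ℤ.* a , t ℤ.* b)

-²_ : ℤ² → ℤ²
-² (a , b) = (- a , - b)

gen : ℕ → ℕ → ℕ → ℕ → ℤ²
gen p q k j =
  ( + (q ℕ.^ (2 ℕ.* k ℕ.+ j)) ℤ.- + (q ℕ.^ (2 ℕ.* k ∸ j))
  , - (+ (p ℕ.* q ℕ.^ j)) ℤ.- + (2 ℕ.* q ℕ.^ (2 ℕ.* k)) )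

InD : ℕ → ℕ → ℕ → ℤ² → Set
InD p q k d = ∃[ j ] (j < 2 ℕ.* k × (d ≡ gen p q k j ⊎ d ≡ -² gen p q k j))

InC : ℕ → ℕ → ℕ → ℤ² → Set
InC p q k c = ∃[ m ] ∃[ d ] (InD p q k d × c ≡ (+ (q ℕ.* m ℕ.+ 1)) ·² d)

Adj : (ℤ² → Set) → ℤ² → ℤ² → Set
Adj C u v = C (u -² v)

TriangleFree : (ℤ² → Set) → Set
TriangleFree C = ∀ u v w → u ≢ v → v ≢ w → u ≢ w →
  Adj C u v → Adj C v w → Adj C u w → ⊥

-- Every element of C is u · g_j with u ≡ ±1 (mod q), and a triangle in the Cayley graph
-- gives three such elements summing to zero.
-- The second coordinate of g_j is q^j times a number ≡ -p (mod q) and, for j ≥ 1, the first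
-- is q^(2k-j) times a number ≡ -1 (mod q).  If one of the three indices is strictly smaller (larger)
-- than the other two, the second (first) coordinate of the sum has a unique term of least
-- q-adic order, so it cannot vanish.  If all indices agree, the coefficients themselves
-- would sum to zero, which is impossible since each is ±1 mod q and q ≥ 2.
module Submission where

open import Defs
open import Data.Nat using (ℕ; _<_)
open import Data.Nat.Coprimality using (Coprime)

open import Data.Nat as ℕ using (suc; _≤_; _∸_; _^_; NonZero)
import Data.Nat.Properties as ℕ
import Data.Nat.Divisibility as ℕ
import Data.Nat.Coprimality as Coprime
open import Data.Nat.Tactic.RingSolver as ℕ-Solver using ()
open import Data.Integer as ℤ using (ℤ; +_; -_; _+_; _-_; _*_; _◃_; 0ℤ; 1ℤ)
import Data.Integer.Properties as ℤ
open import Data.Integer.Divisibility.Signed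
  using (_∣_; divides; ∣ᵤ⇒∣; ∣⇒∣ᵤ; ∣-refl; ∣m+n∣n⇒∣m; ∣n⇒∣m*n; ∣m⇒∣m*n; *-cancelˡ-∣)
open import Data.Integer.Tactic.RingSolver using (solve-∀)
open import Data.Sign as Sign using (Sign; opposite)
open import Data.Empty using (⊥)
open import Data.Product using (_×_; _,_; proj₁; proj₂; ∃-syntax)
open import Data.Sum using (_⊎_; inj₁; inj₂; [_,_])
open import Function using (_∘_)
open import Relation.Binary.Definitions using (tri<; tri≈; tri>)
open import Relation.Binary.PropositionalEquality
  using (_≡_; _≢_; refl; sym; trans; cong; cong₂; subst; subst₂; module ≡-Reasoning)
open import Relation.Nullary using (¬_)

open ≡-Reasoning

pos-^-+ : ∀ q m n → + (q ^ (m ℕ.+ n)) ≡ + (q ^ m) * + (q ^ n)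
pos-^-+ q m n = trans (cong +_ (ℕ.^-distribˡ-+-* q m n)) (ℤ.pos-* (q ^ m) (q ^ n))

pos-^-mono-∣ : ∀ q {m n} → m ≤ n → + (q ^ m) ∣ + (q ^ n)
pos-^-mono-∣ q {m} {n} m≤n = divides (+ (q ^ (n ∸ m))) (begin
  + (q ^ n)                      ≡⟨ cong (λ e → + (q ^ e)) (ℕ.m+[n∸m]≡n m≤n) ⟨
  + (q ^ (m ℕ.+ (n ∸ m)))        ≡⟨ pos-^-+ q m (n ∸ m) ⟩
  + (q ^ m) * + (q ^ (n ∸ m))    ≡⟨ ℤ.*-comm (+ (q ^ m)) _ ⟩
  + (q ^ (n ∸ m)) * + (q ^ m)    ∎)

unique-least-power⇒sum≢0 : ∀ q .{{_ : NonZero q}} {n₁ n₂ n₃} (v₁ w₁ v₂ w₂ v₃ w₃ : ℤ) →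
  n₁ < n₂ → n₁ < n₃ → ¬ (+ q ∣ v₁ * w₁) →
  v₁ * (+ (q ^ n₁) * w₁) + v₂ * (+ (q ^ n₂) * w₂) + v₃ * (+ (q ^ n₃) * w₃)
    ≢ 0ℤ
unique-least-power⇒sum≢0 q {n₁} v₁ w₁ v₂ w₂ v₃ w₃ n₁<n₂ n₁<n₃ q∤v₁w₁ sum≡0 =
  q∤v₁w₁ (*-cancelˡ-∣ (+ (q ^ n₁)) {{ℕ.m^n≢0 q n₁}}
            (subst₂ _∣_ modulus leading-term q^[1+n₁]∣leading))
  where
  q^[1+n₁]∣term : ∀ {n} v w → n₁ < n → + (q ^ suc n₁) ∣ v * (+ (q ^ n) * w)
  q^[1+n₁]∣term v w n₁<n = ∣n⇒∣m*n v (∣m⇒∣m*n w (pos-^-mono-∣ q n₁<n))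

  q^[1+n₁]∣leading : + (q ^ suc n₁) ∣ v₁ * (+ (q ^ n₁) * w₁)
  q^[1+n₁]∣leading =
    ∣m+n∣n⇒∣m (∣m+n∣n⇒∣m (subst (+ (q ^ suc n₁) ∣_) (sym sum≡0) (divides 0ℤ refl))
                          (q^[1+n₁]∣term v₃ w₃ n₁<n₃))
              (q^[1+n₁]∣term v₂ w₂ n₁<n₂)

  modulus : + (q ^ suc n₁) ≡ + (q ^ n₁) * + q
  modulus = trans (ℤ.pos-* q (q ^ n₁)) (ℤ.*-comm (+ q) _)

  leading-term : v₁ * (+ (q ^ n₁) * w₁) ≡ + (q ^ n₁) * (v₁ * w₁)
  leading-term = exchange v₁ (+ (q ^ n₁)) w₁
    where
    exchange : ∀ a b c → a * (b * c) ≡ b * (a * c)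
    exchange = solve-∀

q∣v*[-n+qr]⇒q∣v : ∀ {q n} (v r : ℤ) → Coprime q n →
  + q ∣ v * (- + n + + q * r) → + q ∣ v
q∣v*[-n+qr]⇒q∣v {q} {n} v r q⊥n q∣v[-n+qr] =
  ∣ᵤ⇒∣ (Coprime.coprime-divisor q⊥n (subst (q ℕ.∣_) ∣v*-n∣≡n*∣v∣ (∣⇒∣ᵤ q∣v*-n)))
  where
  expand : ∀ a b c Q → a * (b + Q * c) ≡ a * b + Q * (a * c)
  expand = solve-∀

  q∣v*-n : + q ∣ v * - + n
  q∣v*-n = ∣m+n∣n⇒∣m (subst (+ q ∣_) (expand v (- + n) r (+ q)) q∣v[-n+qr])
                     (∣m⇒∣m*n (v * r) ∣-refl)

  ∣v*-n∣≡n*∣v∣ : ℤ.∣ v * - + n ∣ ≡ n ℕ.* ℤ.∣ v ∣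
  ∣v*-n∣≡n*∣v∣ = begin
    ℤ.∣ v * - + n ∣         ≡⟨ ℤ.abs-* v (- + n) ⟩
    ℤ.∣ v ∣ ℕ.* ℤ.∣ - + n ∣   ≡⟨ cong (ℤ.∣ v ∣ ℕ.*_) (ℤ.∣-i∣≡∣i∣ (+ n)) ⟩
    ℤ.∣ v ∣ ℕ.* n             ≡⟨ ℕ.*-comm ℤ.∣ v ∣ n ⟩
    n ℕ.* ℤ.∣ v ∣             ∎

q^[1+n]-1≡-1+q*q^n : ∀ q n → + (q ^ suc n) - 1ℤ ≡ - + 1 + + q * + (q ^ n)
q^[1+n]-1≡-1+q*q^n q n = begin
  + (q ℕ.* q ^ n) - 1ℤ       ≡⟨ cong (_- 1ℤ) (ℤ.pos-* q (q ^ n)) ⟩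
  + q * + (q ^ n) - 1ℤ       ≡⟨ ℤ.+-comm (+ q * + (q ^ n)) (- 1ℤ) ⟩
  - + 1 + + q * + (q ^ n)    ∎

unit : ℕ → Sign → ℕ → ℤ
unit q s m = s ◃ suc (q ℕ.* m)

unit-opposite : ∀ q s m → unit q (opposite s) m ≡ - unit q s m
unit-opposite q Sign.+ m = refl
unit-opposite q Sign.- m = refl

unit≡sign+q* : ∀ q s m → unit q s m ≡ (s ◃ 1) + + q * (s ◃ m)
unit≡sign+q* q s m = begin
  s ◃ (1 ℕ.+ q ℕ.* m)                ≡⟨ ℤ.◃-distrib-+ s 1 (q ℕ.* m) ⟩
  (s ◃ 1) + (s ◃ (q ℕ.* m))          ≡⟨ cong (_+_ (s ◃ 1)) (ℤ.◃-distrib-* Sign.+ s q m) ⟩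
  (s ◃ 1) + (Sign.+ ◃ q) * (s ◃ m)   ≡⟨ cong (λ z → (s ◃ 1) + z * (s ◃ m)) (ℤ.+◃n≡+n q) ⟩
  (s ◃ 1) + + q * (s ◃ m)            ∎

q∤unit : ∀ {q} → q ≢ 1 → ∀ s m → ¬ (+ q ∣ unit q s m)
q∤unit {q} q≢1 s m q∣unit = q≢1 (ℕ.∣1⇒≡1 (subst (q ℕ.∣_) (ℤ.abs-◃ s 1) (∣⇒∣ᵤ q∣sign)))
  where
  q∣sign : + q ∣ (s ◃ 1)
  q∣sign = ∣m+n∣n⇒∣m (subst (+ q ∣_) (unit≡sign+q* q s m) q∣unit)
                     (∣m⇒∣m*n (s ◃ m) ∣-refl)

q∤unit*[-n+qr] : ∀ {q n} → q ≢ 1 → Coprime q n → ∀ s m r →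
  ¬ (+ q ∣ unit q s m * (- + n + + q * r))
q∤unit*[-n+qr] {q} q≢1 q⊥n s m r =
  q∤unit q≢1 s m ∘ q∣v*[-n+qr]⇒q∣v (unit q s m) r q⊥n

mixed-units-sum≢0 : ∀ {q} → q ≢ 1 → ∀ s₁ s₂ s₃ m₁ m₂ m₃ →
  ℤ.∣ (s₁ ◃ 1) + (s₂ ◃ 1) + (s₃ ◃ 1) ∣ ≡ 1 →
  unit q s₁ m₁ + unit q s₂ m₂ + unit q s₃ m₃ ≢ 0ℤ
mixed-units-sum≢0 {q} q≢1 s₁ s₂ s₃ m₁ m₂ m₃ ∣signs∣≡1 sum≡0 =
  q≢1 (ℕ.∣1⇒≡1 (subst (q ℕ.∣_) ∣signs∣≡1 (∣⇒∣ᵤ q∣signs)))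
  where
  regroup : ∀ a₁ a₂ a₃ Q t₁ t₂ t₃ →
    (a₁ + Q * t₁) + (a₂ + Q * t₂) + (a₃ + Q * t₃)
      ≡ (a₁ + a₂ + a₃) + Q * (t₁ + t₂ + t₃)
  regroup = solve-∀

  sum≡signs+q* : unit q s₁ m₁ + unit q s₂ m₂ + unit q s₃ m₃
    ≡ ((s₁ ◃ 1) + (s₂ ◃ 1) + (s₃ ◃ 1)) + + q * ((s₁ ◃ m₁) + (s₂ ◃ m₂) + (s₃ ◃ m₃))
  sum≡signs+q* = trans
    (cong₂ _+_ (cong₂ _+_ (unit≡sign+q* q s₁ m₁) (unit≡sign+q* q s₂ m₂))
               (unit≡sign+q* q s₃ m₃))
    (regroup (s₁ ◃ 1) (s₂ ◃ 1) (s₃ ◃ 1) (+ q) (s₁ ◃ m₁) (s₂ ◃ m₂) (s₃ ◃ m₃))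

  q∣signs : + q ∣ (s₁ ◃ 1) + (s₂ ◃ 1) + (s₃ ◃ 1)
  q∣signs = ∣m+n∣n⇒∣m (subst (+ q ∣_) (trans (sym sum≡0) sum≡signs+q*) (divides 0ℤ refl))
                      (∣m⇒∣m*n _ ∣-refl)

-- Of equal signs, three multipliers sum to a nonzero number; of mixed signs, to ±1 (mod q).
units-sum≢0 : ∀ {q} → q ≢ 1 → ∀ s₁ s₂ s₃ m₁ m₂ m₃ →
  unit q s₁ m₁ + unit q s₂ m₂ + unit q s₃ m₃ ≢ 0ℤ
units-sum≢0 q≢1 Sign.+ Sign.+ Sign.+ m₁ m₂ m₃ ()
units-sum≢0 q≢1 Sign.- Sign.- Sign.- m₁ m₂ m₃ ()
units-sum≢0 q≢1 s₁@Sign.+ s₂@Sign.+ s₃@Sign.- m₁ m₂ m₃ = mixed-units-sum≢0 q≢1 s₁ s₂ s₃ m₁ m₂ m₃ refl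
units-sum≢0 q≢1 s₁@Sign.+ s₂@Sign.- s₃@Sign.+ m₁ m₂ m₃ = mixed-units-sum≢0 q≢1 s₁ s₂ s₃ m₁ m₂ m₃ refl
units-sum≢0 q≢1 s₁@Sign.- s₂@Sign.+ s₃@Sign.+ m₁ m₂ m₃ = mixed-units-sum≢0 q≢1 s₁ s₂ s₃ m₁ m₂ m₃ refl
units-sum≢0 q≢1 s₁@Sign.+ s₂@Sign.- s₃@Sign.- m₁ m₂ m₃ = mixed-units-sum≢0 q≢1 s₁ s₂ s₃ m₁ m₂ m₃ refl
units-sum≢0 q≢1 s₁@Sign.- s₂@Sign.+ s₃@Sign.- m₁ m₂ m₃ = mixed-units-sum≢0 q≢1 s₁ s₂ s₃ m₁ m₂ m₃ refl
units-sum≢0 q≢1 s₁@Sign.- s₂@Sign.- s₃@Sign.+ m₁ m₂ m₃ = mixed-units-sum≢0 q≢1 s₁ s₂ s₃ m₁ m₂ m₃ refl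

Extreme : ℕ → ℕ → ℕ → Set
Extreme i j l = (i < j × i < l) ⊎ (j < i × l < i)

data Arrangement (i j l : ℕ) : Set where
  all-equal      : i ≡ j → i ≡ l → Arrangement i j l
  first-extreme  : Extreme i j l → Arrangement i j l
  second-extreme : Extreme j i l → Arrangement i j l
  third-extreme  : Extreme l j i → Arrangement i j l

arrangement : ∀ i j l → Arrangement i j l
arrangement i j l with ℕ.<-cmp i j | ℕ.<-cmp i l
... | tri< i<j _ _ | tri< i<l _ _ = first-extreme (inj₁ (i<j , i<l))
... | tri< i<j _ _ | tri≈ _ refl _ = second-extreme (inj₂ (i<j , i<j))
... | tri< i<j _ _ | tri> _ _ l<i = third-extreme (inj₁ (ℕ.<-trans l<i i<j , l<i))
... | tri≈ _ refl _ | tri< i<l _ _ = third-extreme (inj₂ (i<l , i<l))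
... | tri≈ _ i≡j _ | tri≈ _ i≡l _ = all-equal i≡j i≡l
... | tri≈ _ refl _ | tri> _ _ l<i = third-extreme (inj₁ (l<i , l<i))
... | tri> _ _ j<i | tri< i<l _ _ = second-extreme (inj₁ (j<i , ℕ.<-trans j<i i<l))
... | tri> _ _ j<i | tri≈ _ refl _ = second-extreme (inj₁ (j<i , j<i))
... | tri> _ _ j<i | tri> _ _ l<i = first-extreme (inj₂ (j<i , l<i))

·²-neg : ∀ t d → t ·² (-² d) ≡ (- t) ·² d
·²-neg t (x , y) = cong₂ _,_ (*-neg x) (*-neg y)
  where
  *-neg : ∀ z → t * - z ≡ - t * z
  *-neg z = trans (sym (ℤ.neg-distribʳ-* t z)) (ℤ.neg-distribˡ-* t z)

module _ (p q k : ℕ) where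

  2k : ℕ
  2k = 2 ℕ.* k

  X Y : ℕ → ℤ
  X j = proj₁ (gen p q k j)
  Y j = proj₂ (gen p q k j)

  X-cofactor Y-cofactor : ℕ → ℤ
  X-cofactor j = + (q ^ (2 ℕ.* j)) - 1ℤ
  Y-cofactor j = - + p - + 2 * + (q ^ (2k ∸ j))

  X≡q^[2k-j]*cofactor : ∀ {j} → j ≤ 2k → X j ≡ + (q ^ (2k ∸ j)) * X-cofactor j
  X≡q^[2k-j]*cofactor {j} j≤2k = begin
    + (q ^ (2k ℕ.+ j)) - + (q ^ (2k ∸ j))
      ≡⟨ cong (λ e → + (q ^ e) - + (q ^ (2k ∸ j))) exponent ⟨
    + (q ^ (2k ∸ j ℕ.+ 2 ℕ.* j)) - + (q ^ (2k ∸ j))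
      ≡⟨ cong (_- + (q ^ (2k ∸ j))) (pos-^-+ q (2k ∸ j) (2 ℕ.* j)) ⟩
    + (q ^ (2k ∸ j)) * + (q ^ (2 ℕ.* j)) - + (q ^ (2k ∸ j))
      ≡⟨ factor (+ (q ^ (2k ∸ j))) (+ (q ^ (2 ℕ.* j))) ⟩
    + (q ^ (2k ∸ j)) * X-cofactor j                   ∎
    where
    double : ∀ d i → d ℕ.+ 2 ℕ.* i ≡ d ℕ.+ i ℕ.+ i
    double = ℕ-Solver.solve-∀
    exponent : 2k ∸ j ℕ.+ 2 ℕ.* j ≡ 2k ℕ.+ j
    exponent = trans (double (2k ∸ j) j) (cong (ℕ._+ j) (ℕ.m∸n+n≡m j≤2k))
    factor : ∀ a b → a * b - a ≡ a * (b - 1ℤ)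
    factor = solve-∀

  Y≡q^j*cofactor : ∀ {j} → j ≤ 2k → Y j ≡ + (q ^ j) * Y-cofactor j
  Y≡q^j*cofactor {j} j≤2k = begin
    - + (p ℕ.* q ^ j) - + (2 ℕ.* q ^ 2k)
      ≡⟨ cong₂ (λ a b → - a - b) (ℤ.pos-* p (q ^ j)) (ℤ.pos-* 2 (q ^ 2k)) ⟩
    - (+ p * + (q ^ j)) - + 2 * + (q ^ 2k)
      ≡⟨ cong (λ e → - (+ p * + (q ^ j)) - + 2 * + (q ^ e)) (ℕ.m+[n∸m]≡n j≤2k) ⟨
    - (+ p * + (q ^ j)) - + 2 * + (q ^ (j ℕ.+ (2k ∸ j)))
      ≡⟨ cong (λ z → - (+ p * + (q ^ j)) - + 2 * z) (pos-^-+ q j (2k ∸ j)) ⟩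
    - (+ p * + (q ^ j)) - + 2 * (+ (q ^ j) * + (q ^ (2k ∸ j)))
      ≡⟨ factor (+ p) (+ (q ^ j)) (+ (q ^ (2k ∸ j))) ⟩
    + (q ^ j) * Y-cofactor j                                ∎
    where
    factor : ∀ P a b → - (P * a) - + 2 * (a * b) ≡ a * (- P - + 2 * b)
    factor = solve-∀

  Y-cofactor-residue : ∀ {j} → j < 2k →
    Y-cofactor j ≡ - + p + + q * - (+ 2 * + (q ^ (2k ∸ suc j)))
  Y-cofactor-residue {j} j<2k = begin
    - + p - + 2 * + (q ^ (2k ∸ j))
      ≡⟨ cong (λ e → - + p - + 2 * + (q ^ e)) (ℕ.+-∸-assoc 1 j<2k) ⟩
    - + p - + 2 * + (q ℕ.* q ^ (2k ∸ suc j))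
      ≡⟨ cong (λ z → - + p - + 2 * z) (ℤ.pos-* q (q ^ (2k ∸ suc j))) ⟩
    - + p - + 2 * (+ q * + (q ^ (2k ∸ suc j)))
      ≡⟨ regroup (- + p) (+ q) (+ (q ^ (2k ∸ suc j))) ⟩
    - + p + + q * - (+ 2 * + (q ^ (2k ∸ suc j)))  ∎
    where
    regroup : ∀ a Q b → a - + 2 * (Q * b) ≡ a + Q * - (+ 2 * b)
    regroup = solve-∀

  Y≢0 : .{{_ : NonZero q}} → ∀ j → Y j ≢ 0ℤ
  Y≢0 j Yj≡0 = ℕ.≢-nonZero⁻¹ b {{ℕ.m*n≢0 2 (q ^ 2k) {{_}} {{ℕ.m^n≢0 q (2k)}}}}
    (ℕ.m+n≡0⇒n≡0 a (cong ℤ.∣_∣ (ℤ.neg-injective {+ (a ℕ.+ b)} {0ℤ}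
      (trans (ℤ.neg-distrib-+ (+ a) (+ b)) Yj≡0))))
    where
    a = p ℕ.* q ^ j
    b = 2 ℕ.* q ^ 2k

  record Term : Set where
    field
      sign       : Sign
      multiplier : ℕ
      index      : ℕ
      index<2k   : index < 2k

  open Term

  coefficient : Term → ℤ
  coefficient t = unit q (sign t) (multiplier t)

  negate : Term → Term
  negate t = record t { sign = opposite (sign t) }

  component : (ℕ → ℤ) → Term → ℤ
  component F t = coefficient t * F (index t)

  component-negate : ∀ F t → component F (negate t) ≡ - component F t
  component-negate F t = trans (cong (_* F (index t)) (unit-opposite q (sign t) (multiplier t)))
                               (sym (ℤ.neg-distribˡ-* (coefficient t) (F (index t))))

  Vanishes : (ℕ → ℤ) → Term → Term → Term → Set
  Vanishes F a b c = component F a + component F b + component F c ≡ 0ℤ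

  vanishes-swap₁₂ : ∀ F a b c → Vanishes F a b c → Vanishes F b a c
  vanishes-swap₁₂ F a b c = trans (swap (component F b) (component F a) (component F c))
    where
    swap : ∀ x y z → x + y + z ≡ y + x + z
    swap = solve-∀

  vanishes-swap₁₃ : ∀ F a b c → Vanishes F a b c → Vanishes F c b a
  vanishes-swap₁₃ F a b c = trans (swap (component F c) (component F b) (component F a))
    where
    swap : ∀ x y z → x + y + z ≡ z + y + x
    swap = solve-∀

  InC⇒term : ∀ {c} → InC p q k c → ∃[ t ] c ≡ coefficient t ·² gen p q k (index t)
  InC⇒term (m , _ , (j , j<2k , inj₁ refl) , refl) =
    record { sign = Sign.+ ; multiplier = m ; index = j ; index<2k = j<2k } ,
    cong (λ n → (+ n) ·² gen p q k j) (ℕ.+-comm (q ℕ.* m) 1)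
  InC⇒term (m , _ , (j , j<2k , inj₂ refl) , refl) =
    record { sign = Sign.- ; multiplier = m ; index = j ; index<2k = j<2k } ,
    trans (·²-neg (+ (q ℕ.* m ℕ.+ 1)) (gen p q k j))
          (cong (λ n → (- + n) ·² gen p q k j) (ℕ.+-comm (q ℕ.* m) 1))

  triangle⇒vanishes : ∀ F (u v w : ℤ) a b c →
    u - v ≡ component F a → v - w ≡ component F b → u - w ≡ component F c →
    Vanishes F a b (negate c)
  triangle⇒vanishes F u v w a b c ea eb ec = begin
    component F a + component F b + component F (negate c)
      ≡⟨ cong₂ _+_ (cong₂ _+_ (sym ea) (sym eb))
                   (trans (component-negate F c) (cong -_ (sym ec))) ⟩
    (u - v) + (v - w) + - (u - w)
      ≡⟨ telescope u v w ⟩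
    0ℤ  ∎
    where
    telescope : ∀ x y z → (x - y) + (y - z) + - (x - z) ≡ 0ℤ
    telescope = solve-∀

  module _ .{{_ : NonZero q}} (q≢1 : q ≢ 1) (q⊥p : Coprime q p) where

    isolated-min⇒¬vanishes : ∀ a b c → index a < index b → index a < index c →
      ¬ Vanishes Y a b c
    isolated-min⇒¬vanishes a b c a<b a<c vanishes =
      unique-least-power⇒sum≢0 q (coefficient a) (Y-cofactor (index a))
        (coefficient b) (Y-cofactor (index b)) (coefficient c) (Y-cofactor (index c))
        a<b a<c q∤leading (trans (sym factored) vanishes)
      where
      factor : ∀ t → component Y t ≡ coefficient t * (+ (q ^ index t) * Y-cofactor (index t))
      factor t = cong (coefficient t *_) (Y≡q^j*cofactor (ℕ.<⇒≤ (index<2k t)))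
      factored = cong₂ _+_ (cong₂ _+_ (factor a) (factor b)) (factor c)
      q∤leading : ¬ (+ q ∣ coefficient a * Y-cofactor (index a))
      q∤leading = subst (λ w → ¬ (+ q ∣ coefficient a * w))
        (sym (Y-cofactor-residue (index<2k a)))
        (q∤unit*[-n+qr] q≢1 q⊥p (sign a) (multiplier a) _)

    -- Strictly largest index means strictly least power q^(2k-j) in the first coordinate.
    isolated-max⇒¬vanishes : ∀ a b c → index b < index a → index c < index a →
      ¬ Vanishes X a b c
    isolated-max⇒¬vanishes a b c b<a c<a vanishes =
      unique-least-power⇒sum≢0 q (coefficient a) (X-cofactor (index a))
        (coefficient b) (X-cofactor (index b)) (coefficient c) (X-cofactor (index c))
        (reverse b<a) (reverse c<a) (q∤leading (index a) (ℕ.≤-<-trans ℕ.z≤n b<a))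
        (trans (sym factored) vanishes)
      where
      reverse : ∀ {i} → i < index a → 2k ∸ index a < 2k ∸ i
      reverse i<a = ℕ.∸-monoʳ-< i<a (ℕ.<⇒≤ (index<2k a))
      factor : ∀ t →
        component X t ≡ coefficient t * (+ (q ^ (2k ∸ index t)) * X-cofactor (index t))
      factor t = cong (coefficient t *_) (X≡q^[2k-j]*cofactor (ℕ.<⇒≤ (index<2k t)))
      factored = cong₂ _+_ (cong₂ _+_ (factor a) (factor b)) (factor c)
      q∤leading : ∀ j → 0 < j → ¬ (+ q ∣ coefficient a * X-cofactor j)
      q∤leading (suc i) _ = subst (λ w → ¬ (+ q ∣ coefficient a * w))
        (sym (q^[1+n]-1≡-1+q*q^n q (ℕ.pred (2 ℕ.* suc i))))
        (q∤unit*[-n+qr] q≢1 (Coprime.sym (Coprime.1-coprimeTo q)) (sign a) (multiplier a) _)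

    equal-indices⇒¬vanishes : ∀ a b c → index a ≡ index b → index a ≡ index c →
      ¬ Vanishes Y a b c
    equal-indices⇒¬vanishes a b c a≡b a≡c vanishes =
      [ units-sum≢0 q≢1 (sign a) (sign b) (sign c) (multiplier a) (multiplier b) (multiplier c)
      , Y≢0 (index a)
      ] (ℤ.i*j≡0⇒i≡0∨j≡0 (coefficient a + coefficient b + coefficient c)
                          (trans (sym factored) vanishes))
      where
      distrib : ∀ x y z w → x * w + y * w + z * w ≡ (x + y + z) * w
      distrib = solve-∀
      factored : component Y a + component Y b + component Y c
        ≡ (coefficient a + coefficient b + coefficient c) * Y (index a)
      factored = trans
        (cong₂ (λ i l → component Y a + coefficient b * Y i + coefficient c * Y l)
               (sym a≡b) (sym a≡c))
        (distrib (coefficient a) (coefficient b) (coefficient c) (Y (index a)))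

    extreme⇒¬vanishes : ∀ a b c → Extreme (index a) (index b) (index c) →
      Vanishes X a b c → Vanishes Y a b c → ⊥
    extreme⇒¬vanishes a b c (inj₁ (a<b , a<c)) _  vY = isolated-min⇒¬vanishes a b c a<b a<c vY
    extreme⇒¬vanishes a b c (inj₂ (b<a , c<a)) vX _  = isolated-max⇒¬vanishes a b c b<a c<a vX

    ¬vanishes : ∀ a b c → Vanishes X a b c → Vanishes Y a b c → ⊥
    ¬vanishes a b c vX vY with arrangement (index a) (index b) (index c)
    ... | all-equal a≡b a≡c = equal-indices⇒¬vanishes a b c a≡b a≡c vY
    ... | first-extreme e   = extreme⇒¬vanishes a b c e vX vY
    ... | second-extreme e  =
      extreme⇒¬vanishes b a c e (vanishes-swap₁₂ X a b c vX) (vanishes-swap₁₂ Y a b c vY)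
    ... | third-extreme e   =
      extreme⇒¬vanishes c b a e (vanishes-swap₁₃ X a b c vX) (vanishes-swap₁₃ Y a b c vY)

    triangle-free : TriangleFree (InC p q k)
    triangle-free u v w _ _ _ u~v v~w u~w
      with InC⇒term u~v | InC⇒term v~w | InC⇒term u~w
    ... | a , u-v≡a | b , v-w≡b | c , u-w≡c =
      ¬vanishes a b (negate c)
        (triangle⇒vanishes X (proj₁ u) (proj₁ v) (proj₁ w) a b c
          (cong proj₁ u-v≡a) (cong proj₁ v-w≡b) (cong proj₁ u-w≡c))
        (triangle⇒vanishes Y (proj₂ u) (proj₂ v) (proj₂ w) a b c
          (cong proj₂ u-v≡a) (cong proj₂ v-w≡b) (cong proj₂ u-w≡c))

proposition9 : (p q k : ℕ) → 0 < p → 0 < q → 0 < k → Coprime p q → p < q →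
    TriangleFree (InC p q k)
proposition9 p q k 0<p 0<q _ p⊥q p<q =
  triangle-free p q k {{ℕ.>-nonZero 0<q}} (ℕ.>⇒≢ (ℕ.≤-<-trans 0<p p<q)) (Coprime.sym p⊥q)
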